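{- Let $P$ be a partially ordered pattern (a partial order on $\{1,\ldots,k\}$). If the permutation class $\operatorname{Av}(P)$ has a regular insertion encoding, then $P$ is bipartite, i.e. $P$ contains no chain of three elements (has height at most $2$).
   Context: A permutation $\pi$ of size $n$ contains the POP $P$ if there are indices $i_1<i_2<\cdots<i_k$ such that $\pi(i_a)<\pi(i_b)$ whenever $a<_P b$; $\operatorname{Av}(P)$ is the set of all permutations (of all sizes) avoiding $P$. Insertion encoding: a permutation of size $n$ is built by inserting the values $1,2,\ldots,n$ in increasing order into a configuration, a word over the symbols $\bullet$ (placed entry) and $\diamond$ (slot), starting from the single slot $\diamond$. At step $j$ the value $j$ is inserted into the $i$-th slot from the left by one of four operations: $f_i$ replaces that slot by $\bullet$, $l_i$ by $\bullet\diamond$, $r_i$ by $\diamond\bullet$, $m_i$ by $\diamond\bullet\diamond$; after $n$ steps no slots remain and the left-to-right sequence of inserted values is the permutation. Every permutation has a unique such encoding as a word over the letters $\{f_i,l_i,r_i,m_i : i\ge 1\}$. A permutation class has a regular insertion encoding if the set of encodings of its members is a regular language over a finite alphabet. -}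

module Defs where

open import Level using (0ℓ)
open import Data.Nat using (ℕ; zero; suc; _<_)
open import Data.Fin as Fin using (Fin; toℕ)
open import Data.Bool using (Bool; true)
open import Data.Product using (Σ; _×_; _,_)
open import Data.List using (List; []; _∷_; _++_; map; length; lookup; foldl)
open import Data.List.Relation.Unary.All using (All)
open import Data.Maybe as Maybe using (Maybe; just; nothing; _>>=_)
open import Relation.Binary using (Rel)
open import Relation.Binary.PropositionalEquality using (_≡_)
open import Relation.Nullary using (¬_)

-- Pattern containment / avoidance for a POP given as a strict order
-- relation R on Fin k  (R a b  means  a <_P b).
-- A permutation is a list of values π = π(1) … π(n).

Contains : {k : ℕ} → Rel (Fin k) 0ℓ → List ℕ → Set
Contains {k} R π =
  Σ (Fin k → Fin (length π)) λ ι →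
    ((a b : Fin k) → a Fin.< b → ι a Fin.< ι b) ×
    ((a b : Fin k) → R a b → lookup π (ι a) < lookup π (ι b))

Avoids : {k : ℕ} → Rel (Fin k) 0ℓ → List ℕ → Set
Avoids R π = ¬ Contains R π

data Op : Set where
  f l r m : Op

-- a letter (op , i) stands for op_i ; slot indices i are 1-based
Letter : Set
Letter = Op × ℕ

data Cell : Set where
  val  : ℕ → Cell
  slot : Cell

replacement : Op → ℕ → List Cell
replacement f v = val v ∷ []
replacement l v = val v ∷ slot ∷ []
replacement r v = slot ∷ val v ∷ []
replacement m v = slot ∷ val v ∷ slot ∷ []

insertAt : Op → ℕ → ℕ → List Cell → Maybe (List Cell)
insertAt op i v [] = nothing
insertAt op i v (val x ∷ c) = Maybe.map (val x ∷_) (insertAt op i v c)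
insertAt op zero v (slot ∷ c) = nothing
insertAt op (suc zero) v (slot ∷ c) = just (replacement op v ++ c)
insertAt op (suc (suc i)) v (slot ∷ c) = Maybe.map (slot ∷_) (insertAt op (suc i) v c)

run : ℕ → List Letter → List Cell → Maybe (List Cell)
run v [] c = just c
run v ((op , i) ∷ w) c = insertAt op i v c >>= run (suc v) w

Encodes : List Letter → List ℕ → Set
Encodes w π = run 1 w (slot ∷ []) ≡ just (map val π)

InEncodingLanguage : {k : ℕ} → Rel (Fin k) 0ℓ → List Letter → Set
InEncodingLanguage R w = Σ (List ℕ) λ π → Encodes w π × Avoids R π

record DFA (A : Set) : Set where
  field
    nStates : ℕ
    start   : Fin nStates
    step    : Fin nStates → A → Fin nStates
    final   : Fin nStates → Bool

Accepts : {A : Set} → DFA A → List A → Set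
Accepts D w = DFA.final D (foldl (DFA.step D) (DFA.start D) w) ≡ true

-- finite alphabet {f_i, l_i, r_i, m_i : 1 ≤ i ≤ N}
embed : {N : ℕ} → Op × Fin N → Letter
embed (op , j) = op , suc (toℕ j)

IndexAtMost : ℕ → Letter → Set
IndexAtMost N (op , i) = i Data.Nat.≤ N

RegularInsertionEncoding : {k : ℕ} → Rel (Fin k) 0ℓ → Set
RegularInsertionEncoding R =
  Σ ℕ λ N → Σ (DFA (Op × Fin N)) λ D →
    ((w : List Letter) → InEncodingLanguage R w → All (IndexAtMost N) w) ×
    ((w : List (Op × Fin N)) →
       (Accepts D w → InEncodingLanguage R (map embed w)) ×
       (InEncodingLanguage R (map embed w) → Accepts D w))

{-# OPTIONS --safe #-}

-- A chain a <_P b <_P c, read in the order of its positions, is a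
-- classical pattern σ of length 3, so every permutation avoiding σ avoids P.
-- Each σ is avoided by one of four families of "weaves": a monotone run of
-- large values interleaved with a monotone run of small values, the large
-- ones in the odd positions.  Their encodings are a block of m's followed by
-- a block of f's.  Three of the families need letters of unbounded index.
-- The fourth is encoded by the words m₁ⁱ f₁ⁱ⁺¹, and a DFA accepting all of
-- them also accepts some m₁ʲ f₁ⁱ⁺¹ with j ≠ i, which encodes nothing:
-- every m opens a slot and every f closes one.

module Submission where

open import Defs
open import Level using (0ℓ)
open import Function using (_∘_)
open import Data.Bool using (true)
open import Data.Empty using (⊥; ⊥-elim)
open import Data.Nat using (ℕ; zero; suc; _+_; _≤_; _<_; z≤n; s≤s; s≤s⁻¹)
open import Data.Nat.Properties
  using ( +-suc; +-comm; +-assoc; +-identityʳ; +-commutativeSemigroup; suc-injective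
        ; ≤-refl; <⇒≤; ≤-<-trans; <-asym; <-irrefl; <⇒≱; m≤m+n; m<m+n; n≤1+n; n<1+n )
open import Algebra.Properties.CommutativeSemigroup +-commutativeSemigroup using (x∙yz≈y∙xz)
open import Data.Fin as Fin using (Fin; toℕ)
open import Data.Fin.Properties using (pigeonhole) renaming (<-cmp to <-cmpᶠ; <-trans to <-transᶠ)
open import Data.Product using (Σ; ∃₂; ∃-syntax; _×_; _,_; proj₁; proj₂)
open import Data.Product.Properties using (≡-dec)
open import Data.List
  using (List; []; _∷_; _++_; _∷ʳ_; map; length; lookup; replicate; reverse; foldl; concatMap)
open import Data.List.Properties
  using ( length-++; length-replicate; length-reverse; map-++; map-replicate; ++-assoc; ++-identityʳ
        ; foldl-++; unfold-reverse; reverse-involutive )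
open import Data.List.Membership.Propositional using (_∈_)
open import Data.List.Membership.Propositional.Properties using (∈-++⁺ˡ; ∈-++⁺ʳ)
open import Data.List.Relation.Unary.Any using (here; there)
open import Data.List.Relation.Unary.All as All using (All; []; _∷_)
open import Data.List.Relation.Unary.All.Properties using () renaming (++⁺ to All-++⁺)
open import Data.List.Relation.Unary.AllPairs using (AllPairs; []; _∷_)
open import Data.List.Relation.Unary.AllPairs.Properties using () renaming (++⁺ to AllPairs-++⁺)
open import Data.Maybe as Maybe using (just; nothing; _>>=_)
open import Relation.Binary using (Rel; IsStrictPartialOrder; Irreflexive; tri<; tri≈; tri>)
open import Relation.Binary.Definitions using (DecidableEquality)
open import Relation.Binary.PropositionalEquality
  using (_≡_; _≢_; refl; sym; trans; cong; cong₂; subst; subst₂; module ≡-Reasoning)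
open import Relation.Nullary using (¬_; Dec; yes; no; ¬?)
open import Relation.Nullary.Decidable using (from-yes)

open ≡-Reasoning

length-∷ʳ : ∀ {A : Set} (xs : List A) x → length (xs ∷ʳ x) ≡ suc (length xs)
length-∷ʳ xs x = trans (length-++ xs) (+-comm (length xs) 1)

data Direction : Set where
  ascending descending : Direction

Ordered : Direction → ℕ → ℕ → Set
Ordered ascending  x y = x < y
Ordered descending x y = y < x

countUp : ℕ → ℕ → List ℕ
countUp v zero    = []
countUp v (suc n) = v ∷ countUp (suc v) n

countDown : ℕ → ℕ → List ℕ
countDown v zero    = []
countDown v (suc n) = countDown (suc v) n ∷ʳ v

monotone : Direction → ℕ → ℕ → List ℕ
monotone ascending  = countUp
monotone descending = countDown

length-monotone : ∀ d v n → length (monotone d v n) ≡ n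
length-monotone ascending  v zero    = refl
length-monotone ascending  v (suc n) = cong suc (length-monotone ascending (suc v) n)
length-monotone descending v zero    = refl
length-monotone descending v (suc n) =
  trans (length-∷ʳ (countDown (suc v) n) v) (cong suc (length-monotone descending (suc v) n))

monotone-lower : ∀ d v n → All (v ≤_) (monotone d v n)
monotone-lower ascending  v zero    = []
monotone-lower ascending  v (suc n) = ≤-refl ∷ All.map <⇒≤ (monotone-lower ascending (suc v) n)
monotone-lower descending v zero    = []
monotone-lower descending v (suc n) =
  All-++⁺ (All.map <⇒≤ (monotone-lower descending (suc v) n)) (≤-refl ∷ [])

monotone-upper : ∀ d v n → All (_< v + n) (monotone d v n)
monotone-upper ascending  v zero    = []
monotone-upper ascending  v (suc n) =
  m<m+n v (s≤s z≤n)
  ∷ subst (λ b → All (_< b) (countUp (suc v) n)) (sym (+-suc v n)) (monotone-upper ascending (suc v) n)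
monotone-upper descending v zero    = []
monotone-upper descending v (suc n) =
  All-++⁺ (subst (λ b → All (_< b) (countDown (suc v) n)) (sym (+-suc v n))
                 (monotone-upper descending (suc v) n))
          (m<m+n v (s≤s z≤n) ∷ [])

monotone-sorted : ∀ d v n → AllPairs (Ordered d) (monotone d v n)
monotone-sorted ascending  v zero    = []
monotone-sorted ascending  v (suc n) =
  monotone-lower ascending (suc v) n ∷ monotone-sorted ascending (suc v) n
monotone-sorted descending v zero    = []
monotone-sorted descending v (suc n) =
  AllPairs-++⁺ (monotone-sorted descending (suc v) n) ([] ∷ [])
               (All.map (_∷ []) (monotone-lower descending (suc v) n))

-- Weaves

data Colour : Set where
  small large : Colour

-- every small value lies below every large one
cross : Direction → Direction → Colour → Colour → Direction
cross dₛ dₗ small small = dₛ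
cross dₛ dₗ large large = dₗ
cross dₛ dₗ small large = ascending
cross dₛ dₗ large small = descending

WeaveOrdered : Direction → Direction → Colour × ℕ → Colour × ℕ → Set
WeaveOrdered dₛ dₗ (c , x) (c′ , y) = Ordered (cross dₛ dₗ c c′) x y

weave : List ℕ → List ℕ → List (Colour × ℕ)
weave []       ss       = []
weave (a ∷ ls) []       = (large , a) ∷ []
weave (a ∷ ls) (b ∷ ss) = (large , a) ∷ (small , b) ∷ weave ls ss

values : List (Colour × ℕ) → List ℕ
values = map proj₂

All-weave : ∀ {P : Colour × ℕ → Set} {ls ss} →
  All (λ x → P (large , x)) ls → All (λ x → P (small , x)) ss → All P (weave ls ss)
All-weave []          _           = []
All-weave (pa ∷ _)    []          = pa ∷ []
All-weave (pa ∷ pls)  (pb ∷ pss)  = pa ∷ pb ∷ All-weave pls pss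

weave-sorted : ∀ {dₛ dₗ n ls ss} → AllPairs (Ordered dₗ) ls → AllPairs (Ordered dₛ) ss →
  All (_≤ n) ss → All (n <_) ls → AllPairs (WeaveOrdered dₛ dₗ) (weave ls ss)
weave-sorted {ls = []}              _ _ _ _ = []
weave-sorted {ls = _ ∷ _} {ss = []} _ _ _ _ = [] ∷ []
weave-sorted {dₛ} {dₗ} {ls = a ∷ _} {ss = b ∷ _}
             (a≺ls ∷ ls↕) (b≺ss ∷ ss↕) (b≤n ∷ ss≤n) (n<a ∷ n<ls) =
    (≤-<-trans b≤n n<a
      ∷ All-weave {WeaveOrdered dₛ dₗ (large , a)} a≺ls (All.map (λ y≤n → ≤-<-trans y≤n n<a) ss≤n))
  ∷ All-weave {WeaveOrdered dₛ dₗ (small , b)} (All.map (≤-<-trans b≤n) n<ls) b≺ss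
  ∷ weave-sorted ls↕ ss↕ ss≤n n<ls

weave-∷ʳ : ∀ ls ss {a b} → length ls ≡ suc (length ss) →
  weave (ls ∷ʳ a) (ss ∷ʳ b) ≡ weave ls ss ++ (small , b) ∷ (large , a) ∷ []
weave-∷ʳ (x ∷ [])     []       refl = refl
weave-∷ʳ (x ∷ y ∷ ls) (z ∷ ss) eq   =
  cong (λ w → (large , x) ∷ (small , z) ∷ w) (weave-∷ʳ (y ∷ ls) ss (suc-injective eq))

weavePerm : Direction → Direction → ℕ → List (Colour × ℕ)
weavePerm dₛ dₗ n = weave (monotone dₗ (suc n) (suc n)) (monotone dₛ 1 n)

weavePerm-sorted : ∀ dₛ dₗ n → AllPairs (WeaveOrdered dₛ dₗ) (weavePerm dₛ dₗ n)
weavePerm-sorted dₛ dₗ n =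
  weave-sorted (monotone-sorted dₗ (suc n) (suc n)) (monotone-sorted dₛ 1 n)
               (All.map s≤s⁻¹ (monotone-upper dₛ 1 n)) (monotone-lower dₗ (suc n) (suc n))

-- Encoding the weaves

slots : List Cell → ℕ
slots []          = 0
slots (val _ ∷ c) = slots c
slots (slot ∷ c)  = suc (slots c)

slots-vals : ∀ π → slots (map val π) ≡ 0
slots-vals []      = refl
slots-vals (_ ∷ π) = slots-vals π

run-++ : ∀ v w₁ w₂ c → run v (w₁ ++ w₂) c ≡ (run v w₁ c >>= run (v + length w₁) w₂)
run-++ v []              w₂ c rewrite +-identityʳ v = refl
run-++ v ((op , i) ∷ w₁) w₂ c with insertAt op i v c
... | nothing = refl
... | just c₁ rewrite +-suc v (length w₁) = run-++ (suc v) w₁ w₂ c₁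

run-val∷ : ∀ v w x c → run v w (val x ∷ c) ≡ Maybe.map (val x ∷_) (run v w c)
run-val∷ v []              x c = refl
run-val∷ v ((op , i) ∷ w) x c with insertAt op i v c
... | nothing = refl
... | just c₁ = run-val∷ (suc v) w x c₁

gapped : List ℕ → List Cell
gapped xs = slot ∷ concatMap (λ x → val x ∷ slot ∷ []) xs

gapped-∷ʳ : ∀ xs y d → gapped (xs ∷ʳ y) ++ d ≡ gapped xs ++ val y ∷ slot ∷ d
gapped-∷ʳ []       y d = refl
gapped-∷ʳ (x ∷ xs) y d = cong (λ c → slot ∷ val x ∷ c) (gapped-∷ʳ xs y d)

insertAt-mLast : ∀ v xs → insertAt m (suc (length xs)) v (gapped xs) ≡ just (gapped (xs ∷ʳ v))
insertAt-mLast v []       = refl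
insertAt-mLast v (x ∷ xs) rewrite insertAt-mLast v xs = refl

insertAt-lastGap : ∀ op v zs y d {n} → length zs ≡ n →
  insertAt op (suc (suc n)) v (gapped zs ++ val y ∷ slot ∷ d) ≡ just (gapped zs ++ val y ∷ replacement op v ++ d)
insertAt-lastGap op v []       y d refl = refl
insertAt-lastGap op v (z ∷ zs) y d refl rewrite insertAt-lastGap op v zs y d refl = refl

mAscending : ℕ → ℕ → List Letter
mAscending s zero    = []
mAscending s (suc n) = (m , suc s) ∷ mAscending (suc s) n

fDescending : ℕ → List Letter
fDescending zero    = (f , 1) ∷ []
fDescending (suc n) = (f , suc (suc n)) ∷ fDescending n

length-mAscending : ∀ s n → length (mAscending s n) ≡ n
length-mAscending s zero    = refl
length-mAscending s (suc n) = cong suc (length-mAscending (suc s) n)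

mAscending-last : ∀ s n → (m , suc n + s) ∈ mAscending s (suc n)
mAscending-last s zero    = here refl
mAscending-last s (suc n) =
  there (subst (λ i → (m , i) ∈ mAscending (suc s) (suc n)) (+-suc (suc n) s) (mAscending-last (suc s) n))

run-mAscending : ∀ v n xs {s} → length xs ≡ s →
  run v (mAscending s n) (gapped xs) ≡ just (gapped (xs ++ countUp v n))
run-mAscending v zero    xs refl = cong (just ∘ gapped) (sym (++-identityʳ xs))
run-mAscending v (suc n) xs refl rewrite insertAt-mLast v xs =
  trans (run-mAscending (suc v) n (xs ∷ʳ v) (length-∷ʳ xs v))
        (cong (just ∘ gapped) (++-assoc xs (v ∷ []) (countUp (suc v) n)))

run-m₁ⁿ : ∀ v n xs → run v (replicate n (m , 1)) (gapped xs) ≡ just (gapped (countDown v n ++ xs))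
run-m₁ⁿ v zero    xs = refl
run-m₁ⁿ v (suc n) xs =
  trans (run-m₁ⁿ (suc v) n (v ∷ xs)) (cong (just ∘ gapped) (sym (++-assoc (countDown (suc v) n) (v ∷ []) xs)))

run-f₁ⁿ : ∀ v xs → run v (replicate (suc (length xs)) (f , 1)) (gapped xs)
                   ≡ just (map val (values (weave (countUp v (suc (length xs))) xs)))
run-f₁ⁿ v []       = refl
run-f₁ⁿ v (x ∷ xs) = begin
    run (suc v) fs (val v ∷ val x ∷ gapped xs)
  ≡⟨ run-val∷ (suc v) fs v (val x ∷ gapped xs) ⟩
    Maybe.map (val v ∷_) (run (suc v) fs (val x ∷ gapped xs))
  ≡⟨ cong (Maybe.map (val v ∷_)) (run-val∷ (suc v) fs x (gapped xs)) ⟩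
    Maybe.map (val v ∷_) (Maybe.map (val x ∷_) (run (suc v) fs (gapped xs)))
  ≡⟨ cong (Maybe.map (val v ∷_) ∘ Maybe.map (val x ∷_)) (run-f₁ⁿ (suc v) xs) ⟩
    just (map val (values (weave (countUp v (suc (length (x ∷ xs)))) (x ∷ xs)))) ∎
  where fs = replicate (suc (length xs)) (f , 1)

-- f_{n+1} fills the rightmost gap first, so the induction runs along
-- reverse ys and carries the completed suffix S
run-fDescending : ∀ ys v S →
  run v (fDescending (length ys)) (gapped (reverse ys) ++ map val S)
  ≡ just (map val (values (weave (countDown v (suc (length ys))) (reverse ys)) ++ S))
run-fDescending []       v S = refl
run-fDescending (y ∷ ys) v S rewrite unfold-reverse y ys = begin
    run v (fDescending (suc n)) (gapped (zs ∷ʳ y) ++ map val S)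
  ≡⟨ cong (run v (fDescending (suc n))) (gapped-∷ʳ zs y (map val S)) ⟩
    (insertAt f (suc (suc n)) v (gapped zs ++ val y ∷ slot ∷ map val S) >>= run (suc v) (fDescending n))
  ≡⟨ cong (_>>= run (suc v) (fDescending n)) (insertAt-lastGap f v zs y (map val S) (length-reverse ys)) ⟩
    run (suc v) (fDescending n) (gapped zs ++ map val (y ∷ v ∷ S))
  ≡⟨ run-fDescending ys (suc v) (y ∷ v ∷ S) ⟩
    just (map val (values large-then-small ++ y ∷ v ∷ S))
  ≡⟨ cong (just ∘ map val) snoc-pair ⟩
    just (map val (values (weave (countDown v (suc (suc n))) (zs ∷ʳ y)) ++ S)) ∎
  where
  n  = length ys
  zs = reverse ys
  large-then-small = weave (countDown (suc v) (suc n)) zs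
  snoc-pair : values large-then-small ++ y ∷ v ∷ S ≡ values (weave (countDown v (suc (suc n))) (zs ∷ʳ y)) ++ S
  snoc-pair = begin
      values large-then-small ++ y ∷ v ∷ S
    ≡⟨ ++-assoc (values large-then-small) (y ∷ v ∷ []) S ⟨
      (values large-then-small ++ y ∷ v ∷ []) ++ S
    ≡⟨ cong (_++ S) (map-++ proj₂ large-then-small ((small , y) ∷ (large , v) ∷ [])) ⟨
      values (large-then-small ++ (small , y) ∷ (large , v) ∷ []) ++ S
    ≡⟨ cong (λ T → values T ++ S) (weave-∷ʳ (countDown (suc v) (suc n)) zs lengths) ⟨
      values (weave (countDown v (suc (suc n))) (zs ∷ʳ y)) ++ S ∎
    where
    lengths : length (countDown (suc v) (suc n)) ≡ suc (length zs)
    lengths = trans (length-monotone descending (suc v) (suc n)) (cong suc (sym (length-reverse ys)))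

smallPhase : Direction → ℕ → List Letter
smallPhase ascending  n = mAscending 0 n
smallPhase descending n = replicate n (m , 1)

largePhase : Direction → ℕ → List Letter
largePhase ascending  n = replicate (suc n) (f , 1)
largePhase descending n = fDescending n

encoding : Direction → Direction → ℕ → List Letter
encoding dₛ dₗ n = smallPhase dₛ n ++ largePhase dₗ n

length-smallPhase : ∀ d n → length (smallPhase d n) ≡ n
length-smallPhase ascending  n = length-mAscending 0 n
length-smallPhase descending n = length-replicate n

run-smallPhase : ∀ d v n → run v (smallPhase d n) (gapped []) ≡ just (gapped (monotone d v n))
run-smallPhase ascending  v n = run-mAscending v n [] refl
run-smallPhase descending v n = trans (run-m₁ⁿ v n []) (cong (just ∘ gapped) (++-identityʳ (countDown v n)))

run-largePhase : ∀ d v xs {n} → length xs ≡ n →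
  run v (largePhase d n) (gapped xs) ≡ just (map val (values (weave (monotone d v (suc n)) xs)))
run-largePhase ascending  v xs refl = run-f₁ⁿ v xs
run-largePhase descending v xs refl =
  subst₂ (λ n zs → run v (fDescending n) (gapped zs) ≡ just (map val (values (weave (countDown v (suc n)) zs))))
         (length-reverse xs) (reverse-involutive xs)
         (begin
             run v (fDescending (length ys)) (gapped (reverse ys))
           ≡⟨ cong (run v (fDescending (length ys))) (++-identityʳ _) ⟨
             run v (fDescending (length ys)) (gapped (reverse ys) ++ map val [])
           ≡⟨ run-fDescending ys v [] ⟩
             just (map val (values (weave (countDown v (suc (length ys))) (reverse ys)) ++ []))
           ≡⟨ cong (just ∘ map val) (++-identityʳ _) ⟩
             just (map val (values (weave (countDown v (suc (length ys))) (reverse ys)))) ∎)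
  where ys = reverse xs

encodes-weavePerm : ∀ dₛ dₗ n → Encodes (encoding dₛ dₗ n) (values (weavePerm dₛ dₗ n))
encodes-weavePerm dₛ dₗ n = begin
    run 1 (smallPhase dₛ n ++ largePhase dₗ n) (gapped [])
  ≡⟨ run-++ 1 (smallPhase dₛ n) (largePhase dₗ n) (gapped []) ⟩
    (run 1 (smallPhase dₛ n) (gapped []) >>= run (suc (length (smallPhase dₛ n))) (largePhase dₗ n))
  ≡⟨ cong₂ (λ c v → c >>= run (suc v) (largePhase dₗ n)) (run-smallPhase dₛ 1 n) (length-smallPhase dₛ n) ⟩
    run (suc n) (largePhase dₗ n) (gapped (monotone dₛ 1 n))
  ≡⟨ run-largePhase dₗ (suc n) (monotone dₛ 1 n) (length-monotone dₛ 1 n) ⟩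
    just (map val (values (weavePerm dₛ dₗ n))) ∎

-- Slot balance

opens closes : Op → ℕ
opens m = 1
opens _ = 0
closes f = 1
closes _ = 0

#opens #closes : List Letter → ℕ
#opens  []             = 0
#opens  ((op , _) ∷ w) = opens op + #opens w
#closes []             = 0
#closes ((op , _) ∷ w) = closes op + #closes w

insertAt-slots : ∀ op i v c {c′} → insertAt op i v c ≡ just c′ → closes op + slots c′ ≡ opens op + slots c
insertAt-slots op i v (val x ∷ c) eq with insertAt op i v c in e
insertAt-slots op i v (val x ∷ c) refl | just c₁ = insertAt-slots op i v c e
insertAt-slots f (suc zero) v (slot ∷ c) refl = refl
insertAt-slots l (suc zero) v (slot ∷ c) refl = refl
insertAt-slots r (suc zero) v (slot ∷ c) refl = refl
insertAt-slots m (suc zero) v (slot ∷ c) refl = refl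
insertAt-slots op (suc (suc i)) v (slot ∷ c) eq with insertAt op (suc i) v c in e
insertAt-slots op (suc (suc i)) v (slot ∷ c) refl | just c₁ = begin
  closes op + suc (slots c₁)  ≡⟨ +-suc (closes op) (slots c₁) ⟩
  suc (closes op + slots c₁)  ≡⟨ cong suc (insertAt-slots op (suc i) v c e) ⟩
  suc (opens op + slots c)    ≡⟨ +-suc (opens op) (slots c) ⟨
  opens op + suc (slots c)    ∎

run-slots : ∀ v w c {c′} → run v w c ≡ just c′ → #closes w + slots c′ ≡ #opens w + slots c
run-slots v []              c refl = refl
run-slots v ((op , i) ∷ w) c {c′} eq with insertAt op i v c in e
... | just c₁ = begin
    (closes op + #closes w) + slots c′  ≡⟨ +-assoc (closes op) (#closes w) (slots c′) ⟩
    closes op + (#closes w + slots c′)  ≡⟨ cong (closes op +_) (run-slots (suc v) w c₁ eq) ⟩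
    closes op + (#opens w + slots c₁)   ≡⟨ x∙yz≈y∙xz (closes op) (#opens w) (slots c₁) ⟩
    #opens w + (closes op + slots c₁)   ≡⟨ cong (#opens w +_) (insertAt-slots op i v c e) ⟩
    #opens w + (opens op + slots c)     ≡⟨ x∙yz≈y∙xz (#opens w) (opens op) (slots c) ⟩
    opens op + (#opens w + slots c)     ≡⟨ +-assoc (opens op) (#opens w) (slots c) ⟨
    (opens op + #opens w) + slots c     ∎

encodes-balance : ∀ {w π} → Encodes w π → #closes w ≡ suc (#opens w)
encodes-balance {w} {π} enc = begin
  #closes w                      ≡⟨ +-identityʳ _ ⟨
  #closes w + 0                  ≡⟨ cong (#closes w +_) (slots-vals π) ⟨
  #closes w + slots (map val π)  ≡⟨ run-slots 1 w (slot ∷ []) enc ⟩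
  #opens w + 1                   ≡⟨ +-comm (#opens w) 1 ⟩
  suc (#opens w)                 ∎

#opens-mᶦfᵏ : ∀ i k → #opens (replicate i (m , 1) ++ replicate k (f , 1)) ≡ i
#opens-mᶦfᵏ zero    zero    = refl
#opens-mᶦfᵏ zero    (suc k) = #opens-mᶦfᵏ zero k
#opens-mᶦfᵏ (suc i) k       = cong suc (#opens-mᶦfᵏ i k)

#closes-mᶦfᵏ : ∀ i k → #closes (replicate i (m , 1) ++ replicate k (f , 1)) ≡ k
#closes-mᶦfᵏ zero    zero    = refl
#closes-mᶦfᵏ zero    (suc k) = cong suc (#closes-mᶦfᵏ zero k)
#closes-mᶦfᵏ (suc i) k       = #closes-mᶦfᵏ i k

mᶦfᵏ-balanced : ∀ {i k π} → Encodes (replicate i (m , 1) ++ replicate k (f , 1)) π → k ≡ suc i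
mᶦfᵏ-balanced {i} {k} enc = begin
  k                ≡⟨ #closes-mᶦfᵏ i k ⟨
  #closes mᶦfᵏ     ≡⟨ encodes-balance {mᶦfᵏ} enc ⟩
  suc (#opens mᶦfᵏ) ≡⟨ cong suc (#opens-mᶦfᵏ i k) ⟩
  suc i            ∎
  where mᶦfᵏ = replicate i (m , 1) ++ replicate k (f , 1)

-- (d₁₂ , d₁₃ , d₂₃): the directions of the three pairs of a triple
Shape : Set
Shape = Direction × Direction × Direction

HasShape : Shape → ℕ → ℕ → ℕ → Set
HasShape (d₁₂ , d₁₃ , d₂₃) x y z = Ordered d₁₂ x y × Ordered d₁₃ x z × Ordered d₂₃ y z

ContainsShape : Shape → List ℕ → Set
ContainsShape σ π =
  ∃[ i ] ∃[ j ] ∃[ k ] i Fin.< j × j Fin.< k × HasShape σ (lookup π i) (lookup π j) (lookup π k)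

Ordered-unique : ∀ {d d′ x y} → Ordered d x y → Ordered d′ x y → d ≡ d′
Ordered-unique {ascending}  {ascending}  _   _   = refl
Ordered-unique {descending} {descending} _   _   = refl
Ordered-unique {ascending}  {descending} x<y y<x = ⊥-elim (<-asym x<y y<x)
Ordered-unique {descending} {ascending}  y<x x<y = ⊥-elim (<-asym x<y y<x)

HasShape-unique : ∀ {σ τ x y z} → HasShape σ x y z → HasShape τ x y z → σ ≡ τ
HasShape-unique (o₁ , o₂ , o₃) (o₁′ , o₂′ , o₃′) =
  cong₂ _,_ (Ordered-unique o₁ o₁′) (cong₂ _,_ (Ordered-unique o₂ o₂′) (Ordered-unique o₃ o₃′))

colourAt : (T : List (Colour × ℕ)) → Fin (length (values T)) → Colour
colourAt (x ∷ T) Fin.zero    = proj₁ x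
colourAt (x ∷ T) (Fin.suc i) = colourAt T i

entry : (T : List (Colour × ℕ)) → Fin (length (values T)) → Colour × ℕ
entry T i = colourAt T i , lookup (values T) i

All-entry : ∀ {P : Colour × ℕ → Set} {T} → All P T → ∀ i → P (entry T i)
All-entry (px ∷ _)   Fin.zero    = px
All-entry (_  ∷ pxs) (Fin.suc i) = All-entry pxs i

AllPairs-entry : ∀ {Q : Colour × ℕ → Colour × ℕ → Set} {T i j} →
  AllPairs Q T → i Fin.< j → Q (entry T i) (entry T j)
AllPairs-entry {i = Fin.zero}  {Fin.suc j} (px ∷ _)   _         = All-entry px j
AllPairs-entry {i = Fin.suc i} {Fin.suc j} (_  ∷ pxs) (s≤s i<j) = AllPairs-entry pxs i<j

weaveShape : Direction → Direction → Colour → Colour → Colour → Shape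
weaveShape dₛ dₗ c₁ c₂ c₃ = cross dₛ dₗ c₁ c₂ , cross dₛ dₗ c₁ c₃ , cross dₛ dₗ c₂ c₃

WeaveAvoids : Direction → Direction → Shape → Set
WeaveAvoids dₛ dₗ σ = ∀ c₁ c₂ c₃ → weaveShape dₛ dₗ c₁ c₂ c₃ ≢ σ

weave-avoids : ∀ {dₛ dₗ σ T} → AllPairs (WeaveOrdered dₛ dₗ) T → WeaveAvoids dₛ dₗ σ →
  ¬ ContainsShape σ (values T)
weave-avoids {dₛ} {dₗ} {σ} {T} sorted avoids (i , j , k , i<j , j<k , shape) =
  avoids (colourAt T i) (colourAt T j) (colourAt T k) (HasShape-unique woven shape)
  where
  woven : HasShape (weaveShape dₛ dₗ (colourAt T i) (colourAt T j) (colourAt T k))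
                   (lookup (values T) i) (lookup (values T) j) (lookup (values T) k)
  woven = AllPairs-entry sorted i<j , AllPairs-entry sorted (<-transᶠ i<j j<k) , AllPairs-entry sorted j<k

_≟ᵈ_ : DecidableEquality Direction
ascending  ≟ᵈ ascending  = yes refl
descending ≟ᵈ descending = yes refl
ascending  ≟ᵈ descending = no λ ()
descending ≟ᵈ ascending  = no λ ()

∀-colour? : {P : Colour → Set} → (∀ c → Dec (P c)) → Dec (∀ c → P c)
∀-colour? P? with P? small | P? large
... | yes ps | yes pl = yes λ { small → ps ; large → pl }
... | no ¬ps | _      = no λ h → ¬ps (h small)
... | yes _  | no ¬pl = no λ h → ¬pl (h large)

weaveAvoids? : ∀ dₛ dₗ σ → Dec (WeaveAvoids dₛ dₗ σ)
weaveAvoids? dₛ dₗ σ = ∀-colour? λ c₁ → ∀-colour? λ c₂ → ∀-colour? λ c₃ →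
  ¬? (≡-dec _≟ᵈ_ (≡-dec _≟ᵈ_ _≟ᵈ_) (weaveShape dₛ dₗ c₁ c₂ c₃) σ)

avoidingWeave : ∀ σ → ∃₂ λ dₛ dₗ → WeaveAvoids dₛ dₗ σ
avoidingWeave σ@(ascending  , ascending  , ascending ) =
  descending , descending , from-yes (weaveAvoids? descending descending σ)
avoidingWeave σ@(descending , descending , descending) =
  ascending , ascending , from-yes (weaveAvoids? ascending ascending σ)
avoidingWeave σ@(descending , ascending  , ascending ) =
  ascending , descending , from-yes (weaveAvoids? ascending descending σ)
avoidingWeave σ@(ascending  , descending , descending) =
  ascending , descending , from-yes (weaveAvoids? ascending descending σ)
avoidingWeave σ@(ascending  , ascending  , descending) =
  descending , ascending , from-yes (weaveAvoids? descending ascending σ)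
avoidingWeave σ@(descending , descending , ascending ) =
  descending , ascending , from-yes (weaveAvoids? descending ascending σ)
-- the last two shapes are not realised by any triple of numbers
avoidingWeave σ@(ascending  , descending , ascending ) =
  ascending , ascending , from-yes (weaveAvoids? ascending ascending σ)
avoidingWeave σ@(descending , ascending  , descending) =
  ascending , ascending , from-yes (weaveAvoids? ascending ascending σ)

module _ {k} {R : Rel (Fin k) 0ℓ} where

  ForcedShape : Set
  ForcedShape = ∃[ σ ] (∀ π → Contains R π → ContainsShape σ π)

  triple-shape : ∀ σ {p q z} → p Fin.< q → q Fin.< z →
    (∀ {h : Fin k → ℕ} → (∀ {u v} → R u v → h u < h v) → HasShape σ (h p) (h q) (h z)) →
    ForcedShape
  triple-shape σ p<q q<z shape = σ , λ π (ι , ι-mono , ι-resp) →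
    ι _ , ι _ , ι _ , ι-mono _ _ p<q , ι-mono _ _ q<z , shape {λ u → lookup π (ι u)} (ι-resp _ _)

  chain-shape : Irreflexive _≡_ R → ∀ {a b c} → R a b → R b c → R a c →
    ForcedShape
  chain-shape irrefl {a} {b} {c} Rab Rbc Rac with <-cmpᶠ a b | <-cmpᶠ b c | <-cmpᶠ a c
  ... | tri≈ _ a≡b _ | _            | _            = ⊥-elim (irrefl a≡b Rab)
  ... | _            | tri≈ _ b≡c _ | _            = ⊥-elim (irrefl b≡c Rbc)
  ... | _            | _            | tri≈ _ a≡c _ = ⊥-elim (irrefl a≡c Rac)
  ... | tri< a<b _ _ | tri< b<c _ _ | _            =
    triple-shape (ascending , ascending , ascending) a<b b<c λ h → h Rab , h Rac , h Rbc
  ... | tri< a<b _ _ | tri> _ _ c<b | tri< a<c _ _ =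
    triple-shape (ascending , ascending , descending) a<c c<b λ h → h Rac , h Rab , h Rbc
  ... | tri< a<b _ _ | tri> _ _ c<b | tri> _ _ c<a =
    triple-shape (descending , descending , ascending) c<a a<b λ h → h Rac , h Rbc , h Rab
  ... | tri> _ _ b<a | tri> _ _ c<b | _            =
    triple-shape (descending , descending , descending) c<b b<a λ h → h Rbc , h Rac , h Rab
  ... | tri> _ _ b<a | tri< b<c _ _ | tri< a<c _ _ =
    triple-shape (descending , ascending , ascending) b<a a<c λ h → h Rab , h Rbc , h Rac
  ... | tri> _ _ b<a | tri< b<c _ _ | tri> _ _ c<a =
    triple-shape (ascending , descending , descending) b<c c<a λ h → h Rbc , h Rab , h Rac

-- Non-regularity

module _ {A : Set} (D : DFA A) where
  open DFA D

  state : List A → Fin nStates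
  state = foldl step start

  accepts-swap-prefix : ∀ {u u′ w} → state u ≡ state u′ → Accepts D (u ++ w) → Accepts D (u′ ++ w)
  accepts-swap-prefix {u} {u′} {w} same accepted = begin
    final (state (u′ ++ w))        ≡⟨ cong final (foldl-++ step start u′ w) ⟩
    final (foldl step (state u′) w) ≡⟨ cong (λ q → final (foldl step q w)) same ⟨
    final (foldl step (state u) w)  ≡⟨ cong final (foldl-++ step start u w) ⟨
    final (state (u ++ w))         ≡⟨ accepted ⟩
    true                           ∎

  powers-collide : (x : A) → ∃₂ λ i j → i < j × state (replicate i x) ≡ state (replicate j x)
  powers-collide x with i , j , i<j , same ← pigeonhole (n<1+n nStates) (λ i → state (replicate (toℕ i) x)) =
    toℕ i , toℕ j , i<j , same

module _ {k} (R : Rel (Fin k) 0ℓ) where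

  weavePerm-inLanguage : ∀ dₛ dₗ → (∀ n → Avoids R (values (weavePerm dₛ dₗ n))) →
    ∀ n → InEncodingLanguage R (encoding dₛ dₗ n)
  weavePerm-inLanguage dₛ dₗ avoid n = values (weavePerm dₛ dₗ n) , encodes-weavePerm dₛ dₗ n , avoid n

  highIndex⇒¬regular : ∀ dₛ dₗ → (∀ n → Avoids R (values (weavePerm dₛ dₗ n))) →
    (∀ N → ∃[ x ] x ∈ encoding dₛ dₗ (suc N) × N < proj₂ x) → ¬ RegularInsertionEncoding R
  highIndex⇒¬regular dₛ dₗ avoid high (N , _ , bounded , _) with x , x∈w , N<x ← high N =
    <⇒≱ N<x (All.lookup (bounded (encoding dₛ dₗ (suc N)) (weavePerm-inLanguage dₛ dₗ avoid (suc N))) x∈w)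

  embed-mᶦfᵏ : ∀ {N} i k → map (embed {suc N}) (replicate i (m , Fin.zero) ++ replicate k (f , Fin.zero))
                            ≡ replicate i (m , 1) ++ replicate k (f , 1)
  embed-mᶦfᵏ i k = trans (map-++ embed (replicate i _) _) (cong₂ _++_ (map-replicate embed i _) (map-replicate embed k _))

  descendingAscending⇒¬regular : (∀ n → Avoids R (values (weavePerm descending ascending n))) →
    ¬ RegularInsertionEncoding R
  descendingAscending⇒¬regular avoid (zero , _ , bounded , _)
    with bounded (encoding descending ascending 0) (weavePerm-inLanguage descending ascending avoid 0)
  ... | () ∷ _
  descendingAscending⇒¬regular avoid (suc N , D , _ , recognised) = pumped (powers-collide D (m , Fin.zero))
    where
    mᶦ fᵏ : ℕ → List (Op × Fin (suc N))
    mᶦ i = replicate i (m , Fin.zero)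
    fᵏ k = replicate k (f , Fin.zero)

    mᶦfᵏ : ℕ → ℕ → List (Op × Fin (suc N))
    mᶦfᵏ i k = mᶦ i ++ fᵏ k

    accepts-balanced : ∀ i → Accepts D (mᶦfᵏ i (suc i))
    accepts-balanced i = proj₂ (recognised (mᶦfᵏ i (suc i)))
      (subst (InEncodingLanguage R) (sym (embed-mᶦfᵏ i (suc i))) (weavePerm-inLanguage descending ascending avoid i))

    accepted⇒balanced : ∀ {i k} → Accepts D (mᶦfᵏ i k) → k ≡ suc i
    accepted⇒balanced {i} {k} accepted with π , enc , _ ← proj₁ (recognised (mᶦfᵏ i k)) accepted =
      mᶦfᵏ-balanced (subst (λ w → Encodes w π) (embed-mᶦfᵏ i k) enc)

    pumped : (∃₂ λ i j → i < j × state D (mᶦ i) ≡ state D (mᶦ j)) → ⊥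
    pumped (i , j , i<j , same) = <-irrefl (suc-injective (accepted⇒balanced {j} {suc i} pumped-accepted)) i<j
      where
      pumped-accepted : Accepts D (mᶦfᵏ j (suc i))
      pumped-accepted = accepts-swap-prefix D {mᶦ i} {mᶦ j} {fᵏ (suc i)} same (accepts-balanced i)

  weaves-avoid⇒¬regular : ∀ dₛ dₗ → (∀ n → Avoids R (values (weavePerm dₛ dₗ n))) → ¬ RegularInsertionEncoding R
  weaves-avoid⇒¬regular descending ascending avoid = descendingAscending⇒¬regular avoid
  weaves-avoid⇒¬regular ascending  ascending avoid = highIndex⇒¬regular ascending ascending avoid λ N →
    (m , suc N + 0) , ∈-++⁺ˡ (mAscending-last 0 N) , m≤m+n (suc N) 0
  weaves-avoid⇒¬regular dₛ descending avoid = highIndex⇒¬regular dₛ descending avoid λ N →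
    (f , suc (suc N)) , ∈-++⁺ʳ (smallPhase dₛ (suc N)) (here refl) , s≤s (n≤1+n N)

theorem4 : (k : ℕ) (R : Rel (Fin k) 0ℓ) → IsStrictPartialOrder _≡_ R →
    RegularInsertionEncoding R →
    ¬ (Σ (Fin k) λ a → Σ (Fin k) λ b → Σ (Fin k) λ c → R a b × R b c)
theorem4 k R spo regular (a , b , c , Rab , Rbc)
  with σ , contains⇒σ ← chain-shape (IsStrictPartialOrder.irrefl spo) Rab Rbc (IsStrictPartialOrder.trans spo Rab Rbc)
  with dₛ , dₗ , avoids ← avoidingWeave σ
  = weaves-avoid⇒¬regular R dₛ dₗ
      (λ n → weave-avoids (weavePerm-sorted dₛ dₗ n) avoids ∘ contains⇒σ (values (weavePerm dₛ dₗ n)))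
      regular
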